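{- Let $T$ be a rooted tree. The coheight profile $\mathbf{x}_h$ of $T$ can be reconstructed from the sampling function $F_T$; that is, if $T,T'$ are rooted trees with $F_T=F_{T'}$, then $T$ and $T'$ have the same coheight profile.
   Context: $T$ is a finite rooted tree with root $v_T$; $h_v$ is the coheight of $v$ (length of the path from $v_T$ to $v$). The coheight profile is $\mathbf{x}_h=\prod_{v\in V(T)}x_{h_v}$ (a monomial in indeterminates $x_0,x_1,\dots$). A coloring $f\colon V(T)\to\mathbb{Z}^+$ is increasing if $f(u)<f(v)$ whenever $u$ is the parent of $v$; $\mathbf{x}_f=\prod_v x_{f(v)}$; $\Gamma^<(T;\mathbf{x})=\sum_{f\text{ increasing}}\mathbf{x}_f$. Monomials are ordered lexicographically by exponent tuples (larger exponent at the first differing index means larger). For $n\in\mathbb{N}$, $\left[\prod_{i\le n}x_i^{e_i}\right]p$ is the sum of the terms of $p$ whose exponent of $x_i$ equals $e_i$ for all $i\le n$. The sampling function is $F_T\left(\prod_{i\le n}x_i^{e_i}\right)=\max\left(\left[\prod_{i\le n}x_i^{e_i}\right]\Gamma^<(T;\mathbf{x})\right)$ (the greatest such monomial, coefficient discarded, or $\varnothing$ if none), where inputs are monomials in $x_1,x_2,\dots$ together with $n$. -}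

module Defs where

open import Data.Nat using (ℕ; zero; suc; _+_; _≤_; _<_; _≡ᵇ_)
open import Data.Bool using (if_then_else_)
open import Data.List using (List; []; _∷_)
open import Data.List.Relation.Unary.All using (All)
open import Data.Product using (Σ; _×_; ∃)
open import Data.Sum using (_⊎_)
open import Relation.Binary.PropositionalEquality using (_≡_)

-- Finite rooted (plane) trees: a root together with the list of subtrees
-- rooted at its children.
data Tree : Set where
  node : List Tree → Tree

-- Monomials in x_0, x_1, ... are represented by their exponent functions
-- ℕ → ℕ (exponent of x_i at i); equality of monomials is pointwise.
Monomial : Set
Monomial = ℕ → ℕ

_≈ₘ_ : Monomial → Monomial → Set
m ≈ₘ m' = ∀ i → m i ≡ m' i

-- Coheight profile x_h = ∏_v x_{h_v}: exponent of x_i is the number of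
-- vertices at distance i from the root.
mutual
  profile : Tree → Monomial
  profile (node ts) zero    = 1
  profile (node ts) (suc i) = profileList ts i

  profileList : List Tree → ℕ → ℕ
  profileList []       i = 0
  profileList (t ∷ ts) i = profile t i + profileList ts i

-- A vertex coloring of a tree is the same tree with a natural-number label
-- at each vertex.
data CTree : Set where
  cnode : ℕ → List CTree → CTree

mutual
  shape : CTree → Tree
  shape (cnode _ cs) = node (shapeList cs)

  shapeList : List CTree → List Tree
  shapeList []       = []
  shapeList (c ∷ cs) = shape c ∷ shapeList cs

mutual
  colMono : CTree → Monomial
  colMono (cnode k cs) i = (if i ≡ᵇ k then 1 else 0) + colMonoList cs i

  colMonoList : List CTree → ℕ → ℕ
  colMonoList []       i = 0
  colMonoList (c ∷ cs) i = colMono c i + colMonoList cs i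

data IncrAbove (b : ℕ) : CTree → Set where
  cnode : ∀ {k cs} → b < k → All (IncrAbove k) cs → IncrAbove b (cnode k cs)

-- Increasing coloring f : V(T) → ℤ⁺ of T (positivity: labels above 0).
IncreasingColoring : Tree → CTree → Set
IncreasingColoring T c = shape c ≡ T × IncrAbove 0 c

-- m is a monomial of Γ^<(T; x) (all coefficients are positive, so the
-- monomials occurring are exactly the x_f, f increasing).
InGamma : Tree → Monomial → Set
InGamma T m = Σ CTree λ c → IncreasingColoring T c × (colMono c ≈ₘ m)

-- m is a term of [∏_{i≤n} x_i^{e_i}] Γ^<(T; x)
Selected : Tree → ℕ → Monomial → Monomial → Set
Selected T n e m = InGamma T m × (∀ i → i ≤ n → m i ≡ e i)

_<ₗ_ : Monomial → Monomial → Set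
m <ₗ m' = ∃ λ k → (∀ j → j < k → m j ≡ m' j) × m k < m' k

_≤ₗ_ : Monomial → Monomial → Set
m ≤ₗ m' = m <ₗ m' ⊎ m ≈ₘ m'

-- F_T(∏_{i≤n} x_i^{e_i}) = m  (m is the greatest selected monomial).
-- F_T(...) = ∅ corresponds to there being no such m.
SamplingValue : Tree → ℕ → Monomial → Monomial → Set
SamplingValue T n e m =
  Selected T n e m × (∀ m' → Selected T n e m' → m' ≤ₗ m)

-- F_T = F_T' : on every input (a monomial in x_1, x_2, ..., i.e. e 0 = 0,
-- together with n), both sampling functions have the same value
-- (including both being ∅).
SameSampling : Tree → Tree → Set
SameSampling T T' =
  ∀ (n : ℕ) (e : Monomial) → e 0 ≡ 0 → ∀ (m : Monomial) →
    (SamplingValue T n e m → SamplingValue T' n e m) ×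
    (SamplingValue T' n e m → SamplingValue T n e m)

module Submission where

open import Defs
open import Data.Nat using (ℕ; zero; suc; _+_; _≤_; _<_; _≡ᵇ_; z≤n; s≤s)
open import Data.Nat.Properties
open import Data.Bool using (if_then_else_)
open import Data.List using (List; []; _∷_)
open import Data.List.Relation.Unary.All using (All; []; _∷_)
open import Data.Product using (_,_; proj₁)
open import Data.Sum using (inj₁; inj₂)
open import Data.Empty using (⊥; ⊥-elim)
open import Relation.Binary using (tri<; tri≈; tri>)
open import Relation.Binary.PropositionalEquality

-- With n = 0 and e = 1, F_T(1) is the lexicographically greatest x_f. Colouring
-- each vertex by its coheight plus one attains it: for f increasing above b, the
-- root's colour k > b contributes x_k, the subtrees are inductively bounded by
-- their profiles shifted to start at k + 1, and starting the shifted profile of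
-- the tree at k rather than at b + 1 only lowers it lexicographically. So F_T(1)
-- is the coheight profile with each x_i replaced by x_{i+1}.

infixl 30 _*ₘ_

_*ₘ_ : Monomial → Monomial → Monomial
(p *ₘ q) i = p i + q i

1ₘ : Monomial
1ₘ _ = 0

var : ℕ → Monomial
var k i = if i ≡ᵇ k then 1 else 0

shift : ℕ → Monomial → Monomial
shift zero    p i       = p i
shift (suc s) p zero    = 0
shift (suc s) p (suc i) = shift s p i

≈ₘ-refl : ∀ {p} → p ≈ₘ p
≈ₘ-refl i = refl

≈ₘ-sym : ∀ {p q} → p ≈ₘ q → q ≈ₘ p
≈ₘ-sym e i = sym (e i)

≤ₗ-respʳ-≈ₘ : ∀ {p q q'} → q ≈ₘ q' → p ≤ₗ q → p ≤ₗ q'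
≤ₗ-respʳ-≈ₘ eq (inj₁ (k , agree , lt)) =
  inj₁ (k , (λ j j<k → trans (agree j j<k) (eq j)) , subst (_ <_) (eq k) lt)
≤ₗ-respʳ-≈ₘ eq (inj₂ e) = inj₂ (λ i → trans (e i) (eq i))

≤ₗ-respˡ-≈ₘ : ∀ {p p' q} → p ≈ₘ p' → p ≤ₗ q → p' ≤ₗ q
≤ₗ-respˡ-≈ₘ eq (inj₁ (k , agree , lt)) =
  inj₁ (k , (λ j j<k → trans (sym (eq j)) (agree j j<k)) , subst (_< _) (eq k) lt)
≤ₗ-respˡ-≈ₘ eq (inj₂ e) = inj₂ (λ i → trans (sym (eq i)) (e i))

<ₗ-trans : ∀ {p q r} → p <ₗ q → q <ₗ r → p <ₗ r
<ₗ-trans (k₁ , agree₁ , lt₁) (k₂ , agree₂ , lt₂) with <-cmp k₁ k₂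
... | tri< k₁<k₂ _ _ =
  k₁ , (λ j j<k → trans (agree₁ j j<k) (agree₂ j (<-trans j<k k₁<k₂))) ,
  <-≤-trans lt₁ (≤-reflexive (agree₂ k₁ k₁<k₂))
... | tri≈ _ refl _ =
  k₁ , (λ j j<k → trans (agree₁ j j<k) (agree₂ j j<k)) , <-trans lt₁ lt₂
... | tri> _ _ k₂<k₁ =
  k₂ , (λ j j<k → trans (agree₁ j (<-trans j<k k₂<k₁)) (agree₂ j j<k)) ,
  ≤-<-trans (≤-reflexive (agree₁ k₂ k₂<k₁)) lt₂

≤ₗ-trans : ∀ {p q r} → p ≤ₗ q → q ≤ₗ r → p ≤ₗ r
≤ₗ-trans (inj₁ p<q) (inj₁ q<r) = inj₁ (<ₗ-trans p<q q<r)
≤ₗ-trans p≤q        (inj₂ q≈r) = ≤ₗ-respʳ-≈ₘ q≈r p≤q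
≤ₗ-trans (inj₂ p≈q) q≤r        = ≤ₗ-respˡ-≈ₘ (≈ₘ-sym p≈q) q≤r

<ₗ-irrefl : ∀ {p} → p <ₗ p → ⊥
<ₗ-irrefl (k , _ , lt) = <-irrefl refl lt

≤ₗ-antisym : ∀ {p q} → p ≤ₗ q → q ≤ₗ p → p ≈ₘ q
≤ₗ-antisym (inj₂ p≈q) _          = p≈q
≤ₗ-antisym (inj₁ _)   (inj₂ q≈p) = ≈ₘ-sym q≈p
≤ₗ-antisym (inj₁ p<q) (inj₁ q<p) = ⊥-elim (<ₗ-irrefl (<ₗ-trans p<q q<p))

*ₘ-monoˡ-≤ₗ : ∀ {p p'} q → p ≤ₗ p' → p *ₘ q ≤ₗ p' *ₘ q
*ₘ-monoˡ-≤ₗ q (inj₁ (k , agree , lt)) =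
  inj₁ (k , (λ j j<k → cong (_+ q j) (agree j j<k)) , +-monoˡ-< (q k) lt)
*ₘ-monoˡ-≤ₗ q (inj₂ e) = inj₂ (λ i → cong (_+ q i) (e i))

*ₘ-monoʳ-≤ₗ : ∀ p {q q'} → q ≤ₗ q' → p *ₘ q ≤ₗ p *ₘ q'
*ₘ-monoʳ-≤ₗ p (inj₁ (k , agree , lt)) =
  inj₁ (k , (λ j j<k → cong (p j +_) (agree j j<k)) , +-monoʳ-< (p k) lt)
*ₘ-monoʳ-≤ₗ p (inj₂ e) = inj₂ (λ i → cong (p i +_) (e i))

*ₘ-mono-≤ₗ : ∀ {p p' q q'} → p ≤ₗ p' → q ≤ₗ q' → p *ₘ q ≤ₗ p' *ₘ q'
*ₘ-mono-≤ₗ {p' = p'} {q = q} p≤p' q≤q' =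
  ≤ₗ-trans (*ₘ-monoˡ-≤ₗ q p≤p') (*ₘ-monoʳ-≤ₗ p' q≤q')

shift-*ₘ : ∀ s p q → shift s (p *ₘ q) ≈ₘ shift s p *ₘ shift s q
shift-*ₘ zero    p q i       = refl
shift-*ₘ (suc s) p q zero    = refl
shift-*ₘ (suc s) p q (suc i) = shift-*ₘ s p q i

shift-1ₘ : ∀ s → shift s 1ₘ ≈ₘ 1ₘ
shift-1ₘ zero    i       = refl
shift-1ₘ (suc s) zero    = refl
shift-1ₘ (suc s) (suc i) = shift-1ₘ s i

shift-below : ∀ s p {j} → j < s → shift s p j ≡ 0
shift-below (suc s) p {zero}  _         = refl
shift-below (suc s) p {suc j} (s≤s j<s) = shift-below s p j<s

shift-at : ∀ s p → shift s p s ≡ p 0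
shift-at zero    p = refl
shift-at (suc s) p = shift-at s p

shift-antimono-≤ₗ : ∀ {s a} p → 0 < p 0 → s ≤ a → shift a p ≤ₗ shift s p
shift-antimono-≤ₗ {s} {a} p 0<p₀ s≤a with m≤n⇒m<n∨m≡n s≤a
... | inj₂ refl = inj₂ ≈ₘ-refl
... | inj₁ s<a  = inj₁ (s , agree , lt)
  where
  agree : ∀ j → j < s → shift a p j ≡ shift s p j
  agree j j<s = trans (shift-below a p (<-trans j<s s<a)) (sym (shift-below s p j<s))
  lt : shift a p s < shift s p s
  lt = subst₂ _<_ (sym (shift-below a p s<a)) (sym (shift-at s p)) 0<p₀

shift-profile-node : ∀ k ts → shift k (profile (node ts)) ≈ₘ var k *ₘ shift (suc k) (profileList ts)
shift-profile-node zero    ts zero    = refl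
shift-profile-node zero    ts (suc i) = refl
shift-profile-node (suc k) ts zero    = refl
shift-profile-node (suc k) ts (suc i) = shift-profile-node k ts i

mutual
  colMono-≤ₗ-shift-profile : ∀ {b c} → IncrAbove b c → colMono c ≤ₗ shift (suc b) (profile (shape c))
  colMono-≤ₗ-shift-profile (cnode {k} {cs} b<k incr) =
    ≤ₗ-trans {q = shift k (profile (node (shapeList cs)))}
      (≤ₗ-respʳ-≈ₘ (≈ₘ-sym (shift-profile-node k (shapeList cs)))
        (*ₘ-monoʳ-≤ₗ (var k) (colMonoList-≤ₗ-shift-profileList incr)))
      (shift-antimono-≤ₗ (profile (node (shapeList cs))) (s≤s z≤n) b<k)

  colMonoList-≤ₗ-shift-profileList : ∀ {k cs} → All (IncrAbove k) cs →
    colMonoList cs ≤ₗ shift (suc k) (profileList (shapeList cs))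
  colMonoList-≤ₗ-shift-profileList {k} [] = inj₂ (≈ₘ-sym (shift-1ₘ (suc k)))
  colMonoList-≤ₗ-shift-profileList {k} {c ∷ cs} (incr ∷ incrs) =
    ≤ₗ-respʳ-≈ₘ (≈ₘ-sym (shift-*ₘ (suc k) (profile (shape c)) (profileList (shapeList cs))))
      (*ₘ-mono-≤ₗ (colMono-≤ₗ-shift-profile incr) (colMonoList-≤ₗ-shift-profileList incrs))

mutual
  depthColoring : ℕ → Tree → CTree
  depthColoring k (node ts) = cnode k (depthColoringList (suc k) ts)

  depthColoringList : ℕ → List Tree → List CTree
  depthColoringList k []       = []
  depthColoringList k (t ∷ ts) = depthColoring k t ∷ depthColoringList k ts

mutual
  shape-depthColoring : ∀ k T → shape (depthColoring k T) ≡ T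
  shape-depthColoring k (node ts) = cong node (shapeList-depthColoringList (suc k) ts)

  shapeList-depthColoringList : ∀ k ts → shapeList (depthColoringList k ts) ≡ ts
  shapeList-depthColoringList k []       = refl
  shapeList-depthColoringList k (t ∷ ts) =
    cong₂ _∷_ (shape-depthColoring k t) (shapeList-depthColoringList k ts)

mutual
  depthColoring-incrAbove : ∀ b T → IncrAbove b (depthColoring (suc b) T)
  depthColoring-incrAbove b (node ts) = cnode ≤-refl (depthColoringList-incrAbove (suc b) ts)

  depthColoringList-incrAbove : ∀ b ts → All (IncrAbove b) (depthColoringList (suc b) ts)
  depthColoringList-incrAbove b []       = []
  depthColoringList-incrAbove b (t ∷ ts) =
    depthColoring-incrAbove b t ∷ depthColoringList-incrAbove b ts

mutual
  colMono-depthColoring : ∀ k T → colMono (depthColoring k T) ≈ₘ shift k (profile T)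
  colMono-depthColoring k (node ts) i =
    trans (cong (var k i +_) (colMonoList-depthColoringList (suc k) ts i))
          (sym (shift-profile-node k ts i))

  colMonoList-depthColoringList : ∀ k ts →
    colMonoList (depthColoringList k ts) ≈ₘ shift k (profileList ts)
  colMonoList-depthColoringList k []       = ≈ₘ-sym (shift-1ₘ k)
  colMonoList-depthColoringList k (t ∷ ts) i =
    trans (cong₂ _+_ (colMono-depthColoring k t i) (colMonoList-depthColoringList k ts i))
          (sym (shift-*ₘ k (profile t) (profileList ts) i))

depthColoring-increasing : ∀ T → IncreasingColoring T (depthColoring 1 T)
depthColoring-increasing T = shape-depthColoring 1 T , depthColoring-incrAbove 0 T

samplingValue-unique : ∀ {T n e m m'} → SamplingValue T n e m → SamplingValue T n e m' → m ≈ₘ m'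
samplingValue-unique (sel , greatest) (sel' , greatest') =
  ≤ₗ-antisym (greatest' _ sel) (greatest _ sel')

samplingValue-shift-profile : ∀ T → SamplingValue T 0 1ₘ (shift 1 (profile T))
samplingValue-shift-profile T = (inGamma , noX₀) , greatest
  where
  inGamma : InGamma T (shift 1 (profile T))
  inGamma = depthColoring 1 T , depthColoring-increasing T , colMono-depthColoring 1 T

  noX₀ : ∀ i → i ≤ 0 → shift 1 (profile T) i ≡ 0
  noX₀ zero z≤n = refl

  greatest : ∀ m → Selected T 0 1ₘ m → m ≤ₗ shift 1 (profile T)
  greatest m ((c , (refl , incr) , c≈m) , _) =
    ≤ₗ-respˡ-≈ₘ c≈m (colMono-≤ₗ-shift-profile incr)

theorem5p1 : (T T' : Tree) → SameSampling T T' → profile T ≈ₘ profile T'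
theorem5p1 T T' same i = shifted-profiles-agree (suc i)
  where
  shifted-profiles-agree : shift 1 (profile T) ≈ₘ shift 1 (profile T')
  shifted-profiles-agree =
    samplingValue-unique
      (proj₁ (same 0 1ₘ refl (shift 1 (profile T))) (samplingValue-shift-profile T))
      (samplingValue-shift-profile T')
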